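{- Let $n$ be an odd positive integer and let $A$ be a positive integer. If $\gcd(A,p-1)<p-1$ for every prime $p$ dividing $n$, then $$\sum_{\substack{1\le j\le n-1\\ \gcd(j,n)=1}} j^A\equiv 0\pmod n.$$ -}

module Defs where

open import Data.Nat using (ℕ; suc; _^_; _∸_; _≟_)
open import Data.Nat.GCD using (gcd)
open import Data.List using (List; map; filter; upTo; drop)
open import Data.Nat.ListAction using (sum)

range1 : ℕ → List ℕ
range1 n = drop 1 (upTo n)

coprimePowerSum : ℕ → ℕ → ℕ
coprimePowerSum n A = sum (map (λ j → j ^ A) (filter (λ j → gcd j n ≟ 1) (range1 n)))

module Submission where

-- For a unit a of n, j ↦ a·j mod n permutes the reduced residues, so
-- a^A·S ≡ S and n ∣ (a^A − 1)·S.  It therefore suffices (∣-from-annihilators)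
-- to find, for each prime p ∣ n, a unit a of n with p ∤ a^A − 1.  Modulo p some
-- b ∈ {1, …, p − 1} has b^A ≢ 1: reducing A modulo p − 1 by Fermat's little
-- theorem (itself a consequence of the same permutation argument), the
-- alternative is that b^r ≡ 1 for all such b with 1 ≤ r < p − 1, giving
-- ∑_{b<p} b^r ≡ p − 1, whereas a binomial recurrence for power sums shows
-- p ∣ ∑_{b<p} b^r.  Finally b is lifted to a unit of n congruent to b mod p.

open import Defs
open import Data.Nat
open import Data.Nat.Properties
open import Data.Nat.DivMod
open import Data.Nat.Divisibility
open import Data.Nat.Induction using (<-rec)
open import Data.Nat.GCD
  using (gcd; gcd[m,n]∣m; gcd[m,n]∣n; gcd-greatest; gcd[m,n]≢0; n/gcd[m,n]≢0; module Bézout)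
open import Data.Nat.Coprimality as Coprime
  using (Coprime; gcd≡1⇒coprime; coprime⇒gcd≡1; coprime-divisor; coprime-Bézout; 0-coprimeTo-m⇒m≡1)
open import Data.Nat.Primality using (Prime; prime⇒irreducible; prime⇒nonTrivial; euclidsLemma)
open import Data.Nat.Primality.Factorisation using (factorise)
open import Data.Nat.Combinatorics using (_C_; nCn≡1; nC1≡n; nCk≡nC[n∸k])
open import Data.Nat.ListAction using (sum; product)
open import Data.Nat.ListAction.Properties using (sum-↭; product-↭)
open import Data.Nat.Tactic.RingSolver using (solve-∀)
open import Algebra.Properties.CommutativeSemigroup *-commutativeSemigroup using (interchange)
open import Data.Fin using (Fin; zero; suc; toℕ; fromℕ; inject₁)
open import Data.Fin.Properties using (toℕ<n; toℕ-inject₁; toℕ-fromℕ; ¬∀⟶∃¬)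
open import Algebra.Properties.Semiring.Sum +-*-semiring
  using (sum-syntax; sum⁺-syntax; sum-cong-≗; sum-init-last; ∑-comm; *-distribˡ-sum)
import Algebra.Properties.CommutativeSemiring.Binomial +-*-commutativeSemiring as Binomial
open import Algebra.Definitions.RawSemiring +-*-rawSemiring using () renaming (_^_ to _^ₛ_; _×_ to _×ₛ_)
open import Data.List using (List; []; _∷_; map; filter; length)
open import Data.List.Properties using (map-∘; filter-all; length-applyUpTo)
open import Data.List.Membership.Propositional using (_∈_)
open import Data.List.Membership.Propositional.Properties
  using (∈-filter⁺; ∈-filter⁻; ∈-applyUpTo⁺; ∈-applyUpTo⁻; ∈-map⁺; ∈-map⁻)
open import Data.List.Membership.Propositional.Properties.WithK using (unique∧set⇒bag)
open import Data.List.Relation.Unary.All as All using (All; []; _∷_)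
import Data.List.Relation.Unary.All.Properties as All
open import Data.List.Relation.Unary.AllPairs using ([]; _∷_)
open import Data.List.Relation.Unary.Any using (here; there)
open import Data.List.Relation.Unary.Unique.Propositional using (Unique)
import Data.List.Relation.Unary.Unique.Propositional.Properties as Unique
open import Data.List.Relation.Binary.Permutation.Propositional using (_↭_)
import Data.List.Relation.Binary.Permutation.Propositional.Properties as Perm
open import Data.List.Relation.Binary.BagAndSetEquality using (∼bag⇒↭)
open import Data.Product using (∃; ∃₂; _×_; _,_; proj₂)
open import Data.Sum using (inj₁; inj₂; [_,_]′)
open import Data.Empty using (⊥-elim)
open import Function using (id)
open import Function.Bundles using (mk⇔)
open import Relation.Nullary using (¬_; yes; no; contradiction)
open import Relation.Binary.PropositionalEquality

module _ {d : ℕ} .{{_ : NonZero d}} where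
  open ≡-Reasoning

  %-cong-+ : ∀ {a a′ b b′} → a % d ≡ a′ % d → b % d ≡ b′ % d → (a + b) % d ≡ (a′ + b′) % d
  %-cong-+ {a} {a′} {b} {b′} a≡a′ b≡b′ = begin
    (a + b) % d             ≡⟨ %-distribˡ-+ a b d ⟩
    (a % d + b % d) % d     ≡⟨ cong₂ (λ x y → (x + y) % d) a≡a′ b≡b′ ⟩
    (a′ % d + b′ % d) % d   ≡⟨ %-distribˡ-+ a′ b′ d ⟨
    (a′ + b′) % d           ∎

  %-cong-* : ∀ {a a′ b b′} → a % d ≡ a′ % d → b % d ≡ b′ % d → (a * b) % d ≡ (a′ * b′) % d
  %-cong-* {a} {a′} {b} {b′} a≡a′ b≡b′ = begin
    (a * b) % d               ≡⟨ %-distribˡ-* a b d ⟩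
    (a % d * (b % d)) % d     ≡⟨ cong₂ (λ x y → (x * y) % d) a≡a′ b≡b′ ⟩
    (a′ % d * (b′ % d)) % d   ≡⟨ %-distribˡ-* a′ b′ d ⟨
    (a′ * b′) % d             ∎

  %-cong-^ : ∀ {a a′} k → a % d ≡ a′ % d → a ^ k % d ≡ a′ ^ k % d
  %-cong-^ zero    a≡a′ = refl
  %-cong-^ (suc k) a≡a′ = %-cong-* a≡a′ (%-cong-^ k a≡a′)

  sum-%-cong : ∀ (f g : ℕ → ℕ) xs → (∀ x → f x % d ≡ g x % d) →
               sum (map f xs) % d ≡ sum (map g xs) % d
  sum-%-cong f g []       f≡g = refl
  sum-%-cong f g (x ∷ xs) f≡g = %-cong-+ (f≡g x) (sum-%-cong f g xs f≡g)

  product-%-cong : ∀ (f g : ℕ → ℕ) xs → (∀ x → f x % d ≡ g x % d) →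
                   product (map f xs) % d ≡ product (map g xs) % d
  product-%-cong f g []       f≡g = refl
  product-%-cong f g (x ∷ xs) f≡g = %-cong-* (f≡g x) (product-%-cong f g xs f≡g)

  %-cong⇒∣∸ : ∀ {x y} → x ≤ y → x % d ≡ y % d → d ∣ y ∸ x
  %-cong⇒∣∸ {x} {y} x≤y x≡y = divides (y / d ∸ x / d) (begin
    y ∸ x                                       ≡⟨ cong₂ _∸_ (m≡m%n+[m/n]*n y d) (m≡m%n+[m/n]*n x d) ⟩
    (y % d + y / d * d) ∸ (x % d + x / d * d)   ≡⟨ cong (λ r → (y % d + y / d * d) ∸ (r + x / d * d)) x≡y ⟩
    (y % d + y / d * d) ∸ (y % d + x / d * d)   ≡⟨ [m+n]∸[m+o]≡n∸o (y % d) (y / d * d) (x / d * d) ⟩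
    y / d * d ∸ x / d * d                       ≡⟨ *-distribʳ-∸ d (y / d) (x / d) ⟨
    (y / d ∸ x / d) * d                         ∎)

  ∣∸⇒%-cong : ∀ {x y} → x ≤ y → d ∣ y ∸ x → x % d ≡ y % d
  ∣∸⇒%-cong {x} {y} x≤y d∣y∸x = begin
    x % d             ≡⟨ %-remove-+ʳ x d∣y∸x ⟨
    (x + (y ∸ x)) % d ≡⟨ cong (_% d) (m+[n∸m]≡n x≤y) ⟩
    y % d             ∎

  %-cancelʳ-coprime-≤ : ∀ {c x y} → Coprime d c → x ≤ y → (x * c) % d ≡ (y * c) % d → x % d ≡ y % d
  %-cancelʳ-coprime-≤ {c} {x} {y} d⊥c x≤y xc≡yc = ∣∸⇒%-cong x≤y (coprime-divisor d⊥c d∣c*[y∸x])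
    where
    d∣c*[y∸x] : d ∣ c * (y ∸ x)
    d∣c*[y∸x] = subst (d ∣_) (trans (sym (*-distribʳ-∸ c y x)) (*-comm (y ∸ x) c))
                  (%-cong⇒∣∸ (*-monoˡ-≤ c x≤y) xc≡yc)

  %-cancelʳ-coprime : ∀ {c x y} → Coprime d c → (x * c) % d ≡ (y * c) % d → x % d ≡ y % d
  %-cancelʳ-coprime {c} {x} {y} d⊥c xc≡yc with ≤-total x y
  ... | inj₁ x≤y = %-cancelʳ-coprime-≤ d⊥c x≤y xc≡yc
  ... | inj₂ y≤x = sym (%-cancelʳ-coprime-≤ d⊥c y≤x (sym xc≡yc))

coprime-∣ʳ : ∀ {c n m} → Coprime c n → m ∣ n → Coprime c m
coprime-∣ʳ c⊥n m∣n (e∣c , e∣m) = c⊥n (e∣c , ∣-trans e∣m m∣n)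

coprime-*ˡ : ∀ {x y n} → Coprime x n → Coprime y n → Coprime (x * y) n
coprime-*ˡ x⊥n y⊥n (e∣xy , e∣n) =
  y⊥n (coprime-divisor (Coprime.sym (coprime-∣ʳ x⊥n e∣n)) e∣xy , e∣n)

coprime-^ʳ : ∀ {a p} k → Coprime a p → Coprime a (p ^ k)
coprime-^ʳ zero    a⊥p (_ , e∣1) = ∣1⇒≡1 e∣1
coprime-^ʳ (suc k) a⊥p = Coprime.sym (coprime-*ˡ (Coprime.sym a⊥p) (Coprime.sym (coprime-^ʳ k a⊥p)))

coprime-product : ∀ {n} xs → All (λ j → Coprime j n) xs → Coprime (product xs) n
coprime-product []       []           (e∣1 , _) = ∣1⇒≡1 e∣1
coprime-product (x ∷ xs) (x⊥n ∷ xs⊥n) = coprime-*ˡ x⊥n (coprime-product xs xs⊥n)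

coprime-% : ∀ {x n} .{{_ : NonZero n}} → Coprime x n → Coprime (x % n) n
coprime-% x⊥n (e∣x%n , e∣n) = x⊥n (∣n∣m%n⇒∣m e∣n e∣x%n , e∣n)

coprime⇒≥1 : ∀ {z n} → 1 < n → Coprime z n → 1 ≤ z
coprime⇒≥1 {zero}  1<n 0⊥n = ⊥-elim (<⇒≢ 1<n (sym (0-coprimeTo-m⇒m≡1 0⊥n)))
coprime⇒≥1 {suc z} _   _   = s≤s z≤n

∤⇒coprime : ∀ {p m} → Prime p → ¬ p ∣ m → Coprime m p
∤⇒coprime p-prime p∤m (e∣m , e∣p) with prime⇒irreducible p-prime e∣p
... | inj₁ e≡1 = e≡1
... | inj₂ refl = ⊥-elim (p∤m e∣m)

^-distribʳ-* : ∀ a b k → (a * b) ^ k ≡ a ^ k * b ^ k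
^-distribʳ-* a b zero    = refl
^-distribʳ-* a b (suc k) = trans (cong (a * b *_) (^-distribʳ-* a b k)) (interchange a b (a ^ k) (b ^ k))

sum-map-*ˡ : ∀ c (g : ℕ → ℕ) xs → sum (map (λ x → c * g x) xs) ≡ c * sum (map g xs)
sum-map-*ˡ c g []       = sym (*-zeroʳ c)
sum-map-*ˡ c g (x ∷ xs) = trans (cong (c * g x +_) (sum-map-*ˡ c g xs)) (sym (*-distribˡ-+ c (g x) _))

product-map-*ˡ : ∀ c xs → product (map (c *_) xs) ≡ c ^ length xs * product xs
product-map-*ˡ c []       = refl
product-map-*ˡ c (x ∷ xs) =
  trans (cong (c * x *_) (product-map-*ˡ c xs)) (interchange c x (c ^ length xs) (product xs))

units : ℕ → List ℕ
units n = filter (λ j → gcd j n ≟ 1) (range1 n)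

∈-range1⁻ : ∀ {j} n → j ∈ range1 n → 1 ≤ j × j < n
∈-range1⁻ (suc n) j∈ with ∈-applyUpTo⁻ suc j∈
... | i , i<n , refl = s≤s z≤n , s≤s i<n

∈-range1⁺ : ∀ {j} n → 1 ≤ j → j < n → j ∈ range1 n
∈-range1⁺ {suc j} (suc n) _ (s≤s j<n) = ∈-applyUpTo⁺ suc j<n

∈-units⁻ : ∀ {j} n → j ∈ units n → 1 ≤ j × j < n × Coprime j n
∈-units⁻ n j∈ with ∈-filter⁻ (λ j → gcd j n ≟ 1) j∈
... | j∈range , gcd≡1 with ∈-range1⁻ n j∈range
... | 1≤j , j<n = 1≤j , j<n , gcd≡1⇒coprime gcd≡1

∈-units⁺ : ∀ {j} n → 1 ≤ j → j < n → Coprime j n → j ∈ units n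
∈-units⁺ n 1≤j j<n j⊥n = ∈-filter⁺ (λ j → gcd j n ≟ 1) (∈-range1⁺ n 1≤j j<n) (coprime⇒gcd≡1 j⊥n)

units-unique : ∀ n → Unique (units n)
units-unique n = Unique.filter⁺ (λ j → gcd j n ≟ 1) (Unique.drop⁺ 1 (Unique.upTo⁺ n))

unique-map⁺ : ∀ (f : ℕ → ℕ) {xs} → (∀ {x y} → x ∈ xs → y ∈ xs → f x ≡ f y → x ≡ y) →
              Unique xs → Unique (map f xs)
unique-map⁺ f inj []         = []
unique-map⁺ f inj (x∉ ∷ xs!) =
  All.map⁺ (All.tabulate (λ y∈ fx≡fy → All.lookup x∉ y∈ (inj (here refl) (there y∈) fx≡fy)))
  ∷ unique-map⁺ f (λ x∈ y∈ → inj (there x∈) (there y∈)) xs!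

inverse : ∀ {a n} .{{_ : NonZero n}} → Coprime a n → ∃ λ c → (a * c) % n ≡ 1 % n
inverse {a} {n} a⊥n with coprime-Bézout a⊥n
... | Bézout.+- x y 1+yn≡xa = x , (begin
  (a * x) % n     ≡⟨ cong (_% n) (trans (*-comm a x) (sym 1+yn≡xa)) ⟩
  (1 + y * n) % n ≡⟨ %-remove-+ʳ 1 (n∣m*n y) ⟩
  1 % n           ∎)
  where open ≡-Reasoning
inverse {a} {n@(suc k)} a⊥n | Bézout.-+ x y 1+xa≡yn = x * k , (begin
  (a * (x * k)) % n             ≡⟨ %-remove-+ʳ (a * (x * k)) (∣-refl {n}) ⟨
  (a * (x * k) + n) % n         ≡⟨ cong (_% n) (regroup₁ a x k) ⟩
  ((1 + x * a) * k + 1) % n     ≡⟨ cong (λ r → (r * k + 1) % n) 1+xa≡yn ⟩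
  (y * n * k + 1) % n           ≡⟨ cong (_% n) (regroup₂ y k) ⟩
  (y * k * n + 1) % n           ≡⟨ %-remove-+ˡ 1 (n∣m*n (y * k)) ⟩
  1 % n                         ∎)
  where
  open ≡-Reasoning
  regroup₁ : ∀ a x k → a * (x * k) + suc k ≡ (1 + x * a) * k + 1
  regroup₁ = solve-∀
  regroup₂ : ∀ y k → y * suc k * k + 1 ≡ y * k * suc k + 1
  regroup₂ = solve-∀

mulMod : (n : ℕ) .{{_ : NonZero n}} → ℕ → ℕ → ℕ
mulMod n a j = (a * j) % n

mulMod-∈ : ∀ {n a j} .{{_ : NonZero n}} → Coprime a n → j ∈ units n → mulMod n a j ∈ units n
mulMod-∈ {n} {a} {j} a⊥n j∈ with ∈-units⁻ n j∈
... | 1≤j , j<n , j⊥n = ∈-units⁺ n (coprime⇒≥1 (≤-<-trans 1≤j j<n) aj⊥n) (m%n<n (a * j) n) aj⊥n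
  where
  aj⊥n : Coprime (mulMod n a j) n
  aj⊥n = coprime-% (coprime-*ˡ a⊥n j⊥n)

module _ {n a : ℕ} .{{_ : NonZero n}} (a⊥n : Coprime a n) where
  open ≡-Reasoning

  mulMod-injective : ∀ {x y} → x ∈ units n → y ∈ units n → mulMod n a x ≡ mulMod n a y → x ≡ y
  mulMod-injective {x} {y} x∈ y∈ ax≡ay with ∈-units⁻ n x∈ | ∈-units⁻ n y∈
  ... | _ , x<n , _ | _ , y<n , _ = begin
    x     ≡⟨ m<n⇒m%n≡m x<n ⟨
    x % n ≡⟨ %-cancelʳ-coprime (Coprime.sym a⊥n) (begin
               (x * a) % n ≡⟨ cong (_% n) (*-comm x a) ⟩
               (a * x) % n ≡⟨ ax≡ay ⟩
               (a * y) % n ≡⟨ cong (_% n) (*-comm a y) ⟩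
               (y * a) % n ∎) ⟩
    y % n ≡⟨ m<n⇒m%n≡m y<n ⟩
    y     ∎

  -- The preimage of z is c·z mod n for an inverse c of a.
  mulMod-surjective : ∀ {z} → z ∈ units n → ∃ λ j → j ∈ units n × mulMod n a j ≡ z
  mulMod-surjective {z} z∈ with inverse a⊥n | ∈-units⁻ n z∈
  ... | c , ac≡1 | 1≤z , z<n , _ = mulMod n c z , mulMod-∈ c⊥n z∈ , a[cz]≡z
    where
    c⊥n : Coprime c n
    c⊥n (e∣c , e∣n) = ∣1⇒≡1 (subst (_ ∣_) (trans ac≡1 (m<n⇒m%n≡m (≤-<-trans 1≤z z<n)))
                                (%-presˡ-∣ (∣n⇒∣m*n a e∣c) e∣n))
    a[cz]≡z : mulMod n a (mulMod n c z) ≡ z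
    a[cz]≡z = begin
      (a * ((c * z) % n)) % n ≡⟨ %-cong-* {a = a} refl (m%n%n≡m%n (c * z) n) ⟩
      (a * (c * z)) % n       ≡⟨ cong (_% n) (*-assoc a c z) ⟨
      (a * c * z) % n         ≡⟨ %-cong-* ac≡1 refl ⟩
      (1 * z) % n             ≡⟨ cong (_% n) (*-identityˡ z) ⟩
      z % n                   ≡⟨ m<n⇒m%n≡m z<n ⟩
      z                       ∎

  mulMod-permutes : map (mulMod n a) (units n) ↭ units n
  mulMod-permutes = ∼bag⇒↭ (unique∧set⇒bag
    (unique-map⁺ (mulMod n a) mulMod-injective (units-unique n))
    (units-unique n)
    (mk⇔ image⇒unit unit⇒image))
    where
    image⇒unit : ∀ {z} → z ∈ map (mulMod n a) (units n) → z ∈ units n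
    image⇒unit z∈ with ∈-map⁻ (mulMod n a) z∈
    ... | j , j∈ , refl = mulMod-∈ a⊥n j∈
    unit⇒image : ∀ {z} → z ∈ units n → z ∈ map (mulMod n a) (units n)
    unit⇒image z∈ with mulMod-surjective z∈
    ... | j , j∈ , refl = ∈-map⁺ (mulMod n a) j∈

powerSum-scale : ∀ {n a} A .{{_ : NonZero n}} → Coprime a n →
                 (a ^ A * coprimePowerSum n A) % n ≡ coprimePowerSum n A % n
powerSum-scale {n} {a} A a⊥n = begin
  (a ^ A * sum (map (_^ A) (units n))) % n       ≡⟨ cong (_% n) (sum-map-*ˡ (a ^ A) (_^ A) (units n)) ⟨
  sum (map (λ j → a ^ A * j ^ A) (units n)) % n  ≡⟨ sum-%-cong _ _ (units n) scale-term ⟩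
  sum (map (λ j → mulMod n a j ^ A) (units n)) % n ≡⟨ cong (λ xs → sum xs % n) (map-∘ (units n)) ⟩
  sum (map (_^ A) (map (mulMod n a) (units n))) % n
    ≡⟨ cong (_% n) (sum-↭ (Perm.map⁺ (_^ A) (mulMod-permutes a⊥n))) ⟩
  sum (map (_^ A) (units n)) % n                 ∎
  where
  open ≡-Reasoning
  scale-term : ∀ j → (a ^ A * j ^ A) % n ≡ mulMod n a j ^ A % n
  scale-term j = trans (cong (_% n) (sym (^-distribʳ-* a j A))) (%-cong-^ A (sym (m%n%n≡m%n (a * j) n)))

units-product-scale : ∀ {n a} .{{_ : NonZero n}} → Coprime a n →
                      (a ^ length (units n) * product (units n)) % n ≡ product (units n) % n
units-product-scale {n} {a} a⊥n = begin
  (a ^ length (units n) * product (units n)) % n ≡⟨ cong (_% n) (product-map-*ˡ a (units n)) ⟨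
  product (map (a *_) (units n)) % n             ≡⟨ product-%-cong _ _ (units n) (λ j → sym (m%n%n≡m%n (a * j) n)) ⟩
  product (map (mulMod n a) (units n)) % n       ≡⟨ cong (_% n) (product-↭ (mulMod-permutes a⊥n)) ⟩
  product (units n) % n                          ∎
  where open ≡-Reasoning

units-prime : ∀ q → Prime (suc q) → units (suc q) ≡ range1 (suc q)
units-prime q p-prime =
  filter-all (λ j → gcd j (suc q) ≟ 1) (All.tabulate λ j∈ → coprime-to-p (∈-range1⁻ (suc q) j∈))
  where
  coprime-to-p : ∀ {j} → 1 ≤ j × j < suc q → gcd j (suc q) ≡ 1
  coprime-to-p {suc j} (_ , j<p) = coprime⇒gcd≡1 (Coprime.sym (Coprime.prime⇒coprime p-prime j<p))

-- Fermat's little theorem: cancel the (unit) product of 1, …, q from the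
-- congruence of units-product-scale.
fermat : ∀ q {b} → Prime (suc q) → Coprime b (suc q) → b ^ q % suc q ≡ 1 % suc q
fermat q {b} p-prime b⊥p = %-cancelʳ-coprime {x = b ^ q} {y = 1} (Coprime.sym P⊥p) (begin
  (b ^ q * P) % suc q                 ≡⟨ cong (λ l → (b ^ l * P) % suc q) #units≡q ⟨
  (b ^ length (units (suc q)) * P) % suc q ≡⟨ units-product-scale b⊥p ⟩
  P % suc q                           ≡⟨ cong (_% suc q) (*-identityˡ P) ⟨
  (1 * P) % suc q                     ∎)
  where
  open ≡-Reasoning
  P = product (units (suc q))
  P⊥p : Coprime P (suc q)
  P⊥p = coprime-product (units (suc q)) (All.tabulate (λ j∈ → proj₂ (proj₂ (∈-units⁻ (suc q) j∈))))
  #units≡q : length (units (suc q)) ≡ q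
  #units≡q = trans (cong length (units-prime q p-prime)) (length-applyUpTo suc q)

^ₛ≡^ : ∀ x n → x ^ₛ n ≡ x ^ n
^ₛ≡^ x zero    = refl
^ₛ≡^ x (suc n) = cong (x *_) (^ₛ≡^ x n)

×ₛ≡* : ∀ n x → n ×ₛ x ≡ n * x
×ₛ≡* zero    x = refl
×ₛ≡* (suc n) x = cong (x +_) (×ₛ≡* n x)

binomial : ∀ x N → suc x ^ N ≡ ∑[ i ≤ N ] ((N C toℕ i) * x ^ toℕ i)
binomial x N = begin
  suc x ^ N                    ≡⟨ cong (_^ N) (+-comm 1 x) ⟩
  (x + 1) ^ N                  ≡⟨ ^ₛ≡^ (x + 1) N ⟨
  (x + 1) ^ₛ N                 ≡⟨ Binomial.theorem N x 1 ⟩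
  Binomial.binomialExpansion x 1 N ≡⟨ sum-cong-≗ {suc N} term ⟩
  ∑[ i ≤ N ] ((N C toℕ i) * x ^ toℕ i) ∎
  where
  open ≡-Reasoning
  term : ∀ i → (N C toℕ i) ×ₛ (x ^ₛ toℕ i * 1 ^ₛ (N ∸ toℕ i)) ≡ (N C toℕ i) * x ^ toℕ i
  term i rewrite ×ₛ≡* (N C toℕ i) (x ^ₛ toℕ i * 1 ^ₛ (N ∸ toℕ i))
               | ^ₛ≡^ x (toℕ i) | ^ₛ≡^ 1 (N ∸ toℕ i) | ^-zeroˡ (N ∸ toℕ i)
               | *-identityʳ (x ^ toℕ i) = refl

∑-last : ∀ n (f : ℕ → ℕ) → ∑[ i ≤ n ] (f (toℕ i)) ≡ ∑[ i < n ] (f (toℕ i)) + f n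
∑-last n f = begin
  ∑[ i ≤ n ] (f (toℕ i)) ≡⟨ sum-init-last (λ i → f (toℕ i)) ⟩
  ∑[ i < n ] (f (toℕ (inject₁ i))) + f (toℕ (fromℕ n))
    ≡⟨ cong₂ _+_ (sum-cong-≗ {n} (λ i → cong f (toℕ-inject₁ i))) (cong f (toℕ-fromℕ n)) ⟩
  ∑[ i < n ] (f (toℕ i)) + f n                      ∎
  where open ≡-Reasoning

∑-∣ : ∀ {d} n (f : Fin n → ℕ) → (∀ i → d ∣ f i) → d ∣ ∑[ i < n ] (f i)
∑-∣ zero    f d∣f = _ ∣0
∑-∣ (suc n) f d∣f = ∣m∣n⇒∣m+n (d∣f zero) (∑-∣ n (λ i → f (suc i)) (λ i → d∣f (suc i)))

powerSum : ℕ → ℕ → ℕ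
powerSum p e = ∑[ k < p ] (toℕ k ^ e)

-- Expanding each (k + 1)^N binomially and summing over k < p, the left side
-- is ∑_{i ≤ N} C(N,i) S_i(p), while the right side is ∑_{k ≤ p} k^N (as N ≥ 1,
-- the term 0^N vanishes), which is S_N(p) + p^N.
powerSum-binomial : ∀ p e → let N = suc e in
                    ∑[ i ≤ N ] ((N C toℕ i) * powerSum p (toℕ i)) ≡ powerSum p N + p ^ N
powerSum-binomial p e = begin
  ∑[ i ≤ N ] ((N C toℕ i) * powerSum p (toℕ i))
    ≡⟨ sum-cong-≗ {suc N} (λ i → *-distribˡ-sum {p} (N C toℕ i) (λ k → toℕ k ^ toℕ i)) ⟩
  ∑[ i ≤ N ] (∑[ k < p ] ((N C toℕ i) * toℕ k ^ toℕ i))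
    ≡⟨ ∑-comm {p} {suc N} (λ k i → (N C toℕ i) * toℕ k ^ toℕ i) ⟨
  ∑[ k < p ] (∑[ i ≤ N ] ((N C toℕ i) * toℕ k ^ toℕ i))
    ≡⟨ sum-cong-≗ {p} (λ k → binomial (toℕ k) N) ⟨
  ∑[ k < p ] (suc (toℕ k) ^ N)
    ≡⟨⟩
  ∑[ k ≤ p ] (toℕ k ^ N)
    ≡⟨ ∑-last p (_^ N) ⟩
  powerSum p N + p ^ N ∎
  where
  open ≡-Reasoning
  N = suc e

powerSum-recurrence : ∀ p e → ∑[ i ≤ e ] ((suc e C toℕ i) * powerSum p (toℕ i)) ≡ p ^ suc e
powerSum-recurrence p e = +-cancelʳ-≡ (powerSum p N) _ _ (begin
  ∑[ i ≤ e ] ((N C toℕ i) * powerSum p (toℕ i)) + powerSum p N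
    ≡⟨ cong (∑[ i ≤ e ] ((N C toℕ i) * powerSum p (toℕ i)) +_) top-term ⟨
  ∑[ i ≤ e ] ((N C toℕ i) * powerSum p (toℕ i)) + (N C N) * powerSum p N
    ≡⟨ ∑-last N (λ i → (N C i) * powerSum p i) ⟨
  ∑[ i ≤ N ] ((N C toℕ i) * powerSum p (toℕ i))
    ≡⟨ powerSum-binomial p e ⟩
  powerSum p N + p ^ N
    ≡⟨ +-comm (powerSum p N) (p ^ N) ⟩
  p ^ N + powerSum p N ∎)
  where
  open ≡-Reasoning
  N = suc e
  top-term : (N C N) * powerSum p N ≡ powerSum p N
  top-term = trans (cong (_* powerSum p N) (nCn≡1 N)) (*-identityˡ (powerSum p N))

-- For a prime p and 0 ≤ e < p − 1, p divides S_e(p).  By strong induction: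
-- the recurrence writes (e+1)·S_e(p) as p^(e+1) minus a combination of the
-- S_i(p) with i < e, and p ∤ e + 1.
powerSum-divisible : ∀ {p} → Prime p → ∀ e → suc e < p → p ∣ powerSum p e
powerSum-divisible {p} p-prime = <-rec _ step
  where
  step : ∀ e → (∀ {i} → i < e → suc i < p → p ∣ powerSum p i) → suc e < p → p ∣ powerSum p e
  step e IH 1+e<p = [ (λ p∣1+e → contradiction (∣⇒≤ p∣1+e) (<⇒≱ 1+e<p)) , id ]′
                      (euclidsLemma (suc e) (powerSum p e) p-prime p∣top-term)
    where
    lower-terms : ℕ
    lower-terms = ∑[ i < e ] ((suc e C toℕ i) * powerSum p (toℕ i))
    p∣lower-terms : p ∣ lower-terms
    p∣lower-terms = ∑-∣ e _ (λ i → ∣n⇒∣m*n (suc e C toℕ i)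
                      (IH (toℕ<n i) (<-trans (s≤s (toℕ<n i)) 1+e<p)))
    C[1+e,e]≡1+e : suc e C e ≡ suc e
    C[1+e,e]≡1+e = trans (sym (nCk≡nC[n∸k] {1} {suc e} (s≤s z≤n))) (nC1≡n (suc e))
    split : lower-terms + suc e * powerSum p e ≡ p ^ suc e
    split = trans (cong (lower-terms +_) (cong (_* powerSum p e) (sym C[1+e,e]≡1+e)))
              (trans (sym (∑-last e (λ i → (suc e C i) * powerSum p i))) (powerSum-recurrence p e))
    p∣top-term : p ∣ suc e * powerSum p e
    p∣top-term = ∣m+n∣m⇒∣n (subst (p ∣_) (sym split) (∣m⇒∣m*n (p ^ e) ∣-refl)) p∣lower-terms

∑-%-ones : ∀ {d} .{{_ : NonZero d}} n (g : Fin n → ℕ) → (∀ k → g k % d ≡ 1 % d) →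
           (∑[ k < n ] (g k)) % d ≡ n % d
∑-%-ones zero    g g≡1 = refl
∑-%-ones (suc n) g g≡1 = %-cong-+ (g≡1 zero) (∑-%-ones n (λ k → g (suc k)) (λ k → g≡1 (suc k)))

-- For a prime p = q + 1 and 1 ≤ r < p − 1, not every b ∈ {1, …, p − 1} is an
-- r-th root of unity modulo p: otherwise S_r(p) = ∑_{b < p} b^r ≡ p − 1,
-- contradicting p ∣ S_r(p).
not-all-roots-of-unity : ∀ q → Prime (suc q) → ∀ r → 1 ≤ r → r < q →
                         ¬ (∀ (k : Fin q) → suc (toℕ k) ^ r % suc q ≡ 1 % suc q)
not-all-roots-of-unity q p-prime r@(suc _) _ r<q all-roots = <⇒≢ (≤-<-trans z≤n r<q) (sym q≡0)
  where
  q≡0 : q ≡ 0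
  q≡0 = begin
    q                   ≡⟨ m<n⇒m%n≡m (n<1+n q) ⟨
    q % suc q           ≡⟨ ∑-%-ones q (λ k → suc (toℕ k) ^ r) all-roots ⟨
    powerSum (suc q) r % suc q ≡⟨ n∣m⇒m%n≡0 _ (suc q) (powerSum-divisible p-prime r (s≤s r<q)) ⟩
    0                   ∎
    where open ≡-Reasoning

^-%-exponent : ∀ {d} .{{_ : NonZero d}} b q .{{_ : NonZero q}} A →
               b ^ q % d ≡ 1 % d → b ^ A % d ≡ b ^ (A % q) % d
^-%-exponent {d} b q A bᵠ≡1 = begin
  b ^ A % d                            ≡⟨ cong (λ e → b ^ e % d) (m≡m%n+[m/n]*n A q) ⟩
  b ^ (A % q + A / q * q) % d          ≡⟨ cong (_% d) (^-distribˡ-+-* b (A % q) (A / q * q)) ⟩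
  (b ^ (A % q) * b ^ (A / q * q)) % d  ≡⟨ %-cong-* {a = b ^ (A % q)} refl bᵐᵠ≡1 ⟩
  (b ^ (A % q) * 1) % d                ≡⟨ cong (_% d) (*-identityʳ _) ⟩
  b ^ (A % q) % d                      ∎
  where
  open ≡-Reasoning
  bᵐᵠ≡1 : b ^ (A / q * q) % d ≡ 1 % d
  bᵐᵠ≡1 = begin
    b ^ (A / q * q) % d   ≡⟨ cong (λ e → b ^ e % d) (*-comm (A / q) q) ⟩
    b ^ (q * (A / q)) % d ≡⟨ cong (_% d) (^-*-assoc b q (A / q)) ⟨
    (b ^ q) ^ (A / q) % d ≡⟨ %-cong-^ (A / q) bᵠ≡1 ⟩
    1 ^ (A / q) % d       ≡⟨ cong (_% d) (^-zeroˡ (A / q)) ⟩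
    1 % d                 ∎

-- gcd(A, q) < q means q ∤ A, i.e. A mod q ≥ 1.
gcd<⇒%≥1 : ∀ A q .{{_ : NonZero q}} → gcd A q < q → 1 ≤ A % q
gcd<⇒%≥1 A q gcd<q = n≢0⇒n>0 λ A%q≡0 →
  <-irrefl (∣-antisym (gcd[m,n]∣n A q) (gcd-greatest (m%n≡0⇒n∣m A q A%q≡0) ∣-refl)) gcd<q

-- Otherwise, reducing the exponent by
-- Fermat, every such b would be an r-th root of unity for r = A mod (p − 1),
-- where 1 ≤ r < p − 1.
exists-non-root : ∀ q A → Prime (suc q) → gcd A q < q →
                  ∃ λ (k : Fin q) → ¬ (suc (toℕ k) ^ A % suc q ≡ 1 % suc q)
exists-non-root q@(suc _) A p-prime gcd<q =
  ¬∀⟶∃¬ q _ (λ k → suc (toℕ k) ^ A % suc q ≟ 1 % suc q) λ all-roots →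
    not-all-roots-of-unity q p-prime (A % q) (gcd<⇒%≥1 A q gcd<q) (m%n<n A q)
      (λ k → trans (sym (^-%-exponent (suc (toℕ k)) q A (fermat q p-prime (b⊥p k)))) (all-roots k))
  where
  b⊥p : ∀ (k : Fin q) → Coprime (suc (toℕ k)) (suc q)
  b⊥p k = Coprime.sym (Coprime.prime⇒coprime p-prime (s≤s (toℕ<n k)))

p-free-part : ∀ {p} → 1 < p → ∀ n → 0 < n → ∃₂ λ k m → n ≡ p ^ k * m × ¬ p ∣ m
p-free-part {p} 1<p = <-rec _ split
  where
  rotate : ∀ x y p → x * y * p ≡ p * x * y
  rotate = solve-∀
  split : ∀ n → (∀ {n′} → n′ < n → 0 < n′ → ∃₂ λ k m → n′ ≡ p ^ k * m × ¬ p ∣ m) →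
          0 < n → ∃₂ λ k m → n ≡ p ^ k * m × ¬ p ∣ m
  split n IH 0<n with p ∣? n
  ... | no p∤n = 0 , n , sym (+-identityʳ n) , p∤n
  ... | yes (divides zero n≡0) = contradiction n≡0 (>⇒≢ 0<n)
  ... | yes (divides c@(suc _) n≡cp) with IH (subst (c <_) (sym n≡cp) (m<m*n c p 1<p)) z<s
  ...   | k , m , c≡pᵏm , p∤m =
    suc k , m , trans n≡cp (trans (cong (_* p) c≡pᵏm) (rotate (p ^ k) m p)) , p∤m

-- Writing n = p^k·m with p ∤ m, the number a = 1 + (b − 1)·m^q is ≡ b (mod p)
-- by Fermat, shares no factor with m, and is prime to p.
lift-to-unit : ∀ n q .{{_ : NonZero q}} t → 0 < n → Prime (suc q) → ¬ suc q ∣ suc t →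
               ∃ λ a → Coprime a n × a % suc q ≡ suc t % suc q
lift-to-unit n q@(suc q′) t 0<n p-prime p∤b
  with p-free-part (nonTrivial⇒n>1 (suc q) {{prime⇒nonTrivial p-prime}}) n 0<n
... | k , m , n≡pᵏm , p∤m = a , a⊥n , a≡b
  where
  p = suc q
  a = suc (t * m ^ q)
  mᵠ≡1 : m ^ q % p ≡ 1 % p
  mᵠ≡1 = fermat q p-prime (∤⇒coprime p-prime p∤m)
  a≡b : a % p ≡ suc t % p
  a≡b = %-cong-+ {d = p} {a = 1} {a′ = 1} {b = t * m ^ q} {b′ = t} refl
          (trans (%-cong-* {d = p} {a = t} {a′ = t} {b = m ^ q} {b′ = 1} refl mᵠ≡1) (cong (_% p) (*-identityʳ t)))
  a⊥m : Coprime a m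
  a⊥m {e} (e∣a , e∣m) = ∣1⇒≡1 (∣m+n∣m⇒∣n (subst (e ∣_) (+-comm 1 (t * m ^ q)) e∣a)
                      (∣n⇒∣m*n t (∣-trans e∣m (m∣m*n (m ^ q′)))))
  a⊥p : Coprime a p
  a⊥p = ∤⇒coprime p-prime λ p∣a → p∤b (m%n≡0⇒n∣m (suc t) p (trans (sym a≡b) (n∣m⇒m%n≡0 a p p∣a)))
  a⊥n : Coprime a n
  a⊥n = subst (Coprime a) (sym n≡pᵏm)
          (Coprime.sym (coprime-*ˡ (Coprime.sym (coprime-^ʳ k a⊥p)) (Coprime.sym a⊥m)))

unit-non-root : ∀ n A p → 0 < n → Prime p → gcd A (p ∸ 1) < p ∸ 1 →
                ∃ λ a → Coprime a n × ¬ p ∣ a ^ A ∸ 1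
unit-non-root n A p@(suc q@(suc _)) 0<n p-prime gcd<q = lift-non-root (exists-non-root q A p-prime gcd<q)
  where
  lift-non-root : (∃ λ (k : Fin q) → ¬ (suc (toℕ k) ^ A % p ≡ 1 % p)) →
                  ∃ λ a → Coprime a n × ¬ p ∣ a ^ A ∸ 1
  lift-non-root (k , bᴬ≢1) = non-root-unit (lift-to-unit n q (toℕ k) 0<n p-prime p∤b)
    where
    p∤b : ¬ p ∣ suc (toℕ k)
    p∤b p∣b = <⇒≱ (s≤s (toℕ<n k)) (∣⇒≤ p∣b)
    non-root-unit : (∃ λ a → Coprime a n × a % p ≡ suc (toℕ k) % p) →
                    ∃ λ a → Coprime a n × ¬ p ∣ a ^ A ∸ 1
    non-root-unit (zero , _ , 0≡b) = contradiction (m%n≡0⇒n∣m (suc (toℕ k)) p (sym 0≡b)) p∤b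
    non-root-unit (a@(suc _) , a⊥n , a≡b) = a , a⊥n , λ p∣aᴬ-1 → bᴬ≢1 (begin
      suc (toℕ k) ^ A % p ≡⟨ %-cong-^ {d = p} {a = a} {a′ = suc (toℕ k)} A a≡b ⟨
      a ^ A % p           ≡⟨ ∣∸⇒%-cong {d = p} {x = 1} {y = a ^ A} (m^n>0 a A) p∣aᴬ-1 ⟨
      1 % p               ∎)
      where open ≡-Reasoning

fixed⇒annihilated : ∀ {n} .{{_ : NonZero n}} x S → (x * S) % n ≡ S % n → n ∣ (x ∸ 1) * S
fixed⇒annihilated         zero      S _     = _ ∣0
fixed⇒annihilated {n} x@(suc _) S xS≡S =
  subst (n ∣_) (sym (*-distribʳ-∸ S x 1))
    (%-cong⇒∣∸ (*-monoˡ-≤ S {1} {x} (s≤s z≤n)) (trans (cong (_% n) (*-identityˡ S)) (sym xS≡S)))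

no-prime-factor⇒≡1 : ∀ m → 0 < m → (∀ p → Prime p → ¬ p ∣ m) → m ≡ 1
no-prime-factor⇒≡1 (suc zero)       _ _ = refl
no-prime-factor⇒≡1 m@(suc (suc _)) _ no-factor with factorise m
... | record { factors = [] ; isFactorisation = m≡Π } = contradiction m≡Π λ ()
... | record { factors = p ∷ ps ; isFactorisation = m≡Π ; factorsPrime = p-prime ∷ _ } =
  contradiction (subst (p ∣_) (sym m≡Π) (m∣m*n (product ps))) (no-factor p p-prime)

-- If each prime p ∣ n admits some x with p ∤ x and n ∣ x·S, then n ∣ S.
-- With g = gcd(S, n): n/g ∣ x·(S/g) and n/g ⊥ S/g give n/g ∣ x, so no prime
-- divides n/g; hence n/g = 1 and n = g ∣ S.
∣-from-annihilators : ∀ n S .{{_ : NonZero n}} →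
                      (∀ p → Prime p → p ∣ n → ∃ λ x → n ∣ x * S × ¬ p ∣ x) → n ∣ S
∣-from-annihilators n S annihilator = subst (_∣ S) g≡n (gcd[m,n]∣m S n)
  where
  g = gcd S n
  instance
    g≢0 : NonZero g
    g≢0 = ≢-nonZero (gcd[m,n]≢0 S n (inj₂ (≢-nonZero⁻¹ n)))
  regroup : ∀ x s g → x * (s * g) ≡ s * x * g
  regroup = solve-∀
  no-factor : ∀ p → Prime p → ¬ p ∣ n / g
  no-factor p p-prime p∣n/g with annihilator p p-prime (∣-trans p∣n/g (m/n∣m (gcd[m,n]∣n S n)))
  ... | x , n∣xS , p∤x = p∤x (∣-trans p∣n/g n/g∣x)
    where
    n/g∣[S/g]x : n / g ∣ S / g * x
    n/g∣[S/g]x = m∣n*o⇒m/n∣o (gcd[m,n]∣n S n)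
                   (subst (n ∣_) (trans (cong (x *_) (sym (m/n*n≡m (gcd[m,n]∣m S n)))) (regroup x (S / g) g)) n∣xS)
    n/g∣x : n / g ∣ x
    n/g∣x = coprime-divisor (Coprime.sym (Coprime.coprime-/gcd S n)) n/g∣[S/g]x
  g≡n : g ≡ n
  g≡n = begin
    g         ≡⟨ *-identityˡ g ⟨
    1 * g     ≡⟨ cong (_* g) (no-prime-factor⇒≡1 (n / g) (n≢0⇒n>0 (n/gcd[m,n]≢0 S n)) no-factor) ⟨
    n / g * g ≡⟨ m/n*n≡m (gcd[m,n]∣n S n) ⟩
    n         ∎
    where open ≡-Reasoning

mainTheorem4 : (n A : ℕ) → 0 < n → n % 2 ≡ 1 → 0 < A →
    (∀ p → Prime p → p ∣ n → gcd A (p ∸ 1) < p ∸ 1) →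
    n ∣ coprimePowerSum n A
mainTheorem4 n@(suc _) A 0<n _ _ hyp = ∣-from-annihilators n (coprimePowerSum n A) annihilator
  where
  annihilator : ∀ p → Prime p → p ∣ n → ∃ λ x → n ∣ x * coprimePowerSum n A × ¬ p ∣ x
  annihilator p p-prime p∣n = annihilate (unit-non-root n A p 0<n p-prime (hyp p p-prime p∣n))
    where
    annihilate : (∃ λ a → Coprime a n × ¬ p ∣ a ^ A ∸ 1) →
                 ∃ λ x → n ∣ x * coprimePowerSum n A × ¬ p ∣ x
    annihilate (a , a⊥n , p∤aᴬ-1) =
      a ^ A ∸ 1 , fixed⇒annihilated (a ^ A) _ (powerSum-scale A a⊥n) , p∤aᴬ-1
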